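{- Let $\alpha$ and $\beta$ be dotted compositions. Then $L_\alpha\bullet L_\beta=L_{\alpha\cdot\beta}$. Moreover, if the last entry of $\alpha$ and the first entry of $\beta$ are both non-dotted, then $L_\alpha\bullet L_\beta+L_\alpha\odot L_\beta=L_{\alpha\odot\beta}$.
   Context: Variables: commuting $x_1,x_2,\dots$ and anticommuting $\theta_1,\theta_2,\dots$ ($\theta_i\theta_j=-\theta_j\theta_i$, $\theta_i^2=0$). A dotted composition is a finite sequence $\alpha=(\alpha_1,\dots,\alpha_l)$ with entries either positive integers (non-dotted) or dotted nonnegative integers $\dot0,\dot1,\dots$; $\eta_i=1$ if $\alpha_i$ is dotted, else $0$. $M_\alpha=\sum_{i_1<\cdots<i_l}\theta_{i_1}^{\eta_1}\cdots\theta_{i_l}^{\eta_l}x_{i_1}^{\alpha_1}\cdots x_{i_l}^{\alpha_l}$ ($M_\emptyset=1$); these form a basis of the $\mathbb Q$-vector space $\mathrm{sQSym}$ of quasisymmetric functions in superspace. The order $\preccurlyeq$ is the reflexive–transitive closure of: $\beta\preccurlyeq\alpha$ if $\alpha$ is obtained from $\beta$ by replacing two adjacent non-dotted parts by their sum; $L_\alpha=\sum_{\beta\preccurlyeq\alpha}M_\beta$. The concatenation of $\alpha=(\alpha_1,\dots,\alpha_k)$ and $\beta=(\beta_1,\dots,\beta_r)$ is $\alpha\cdot\beta=(\alpha_1,\dots,\alpha_k,\beta_1,\dots,\beta_r)$. For nonempty $\alpha,\beta$ with $\alpha_k,\beta_1$ not both dotted, the near concatenation is $\alpha\odot\beta=(\alpha_1,\dots,\alpha_{k-1},\alpha_k+\beta_1,\beta_2,\dots,\beta_r)$,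 where the entry $\alpha_k+\beta_1$ is dotted iff one of $\alpha_k,\beta_1$ is dotted. Define bilinear products on $\mathrm{sQSym}$ by $M_\alpha\bullet M_\beta=M_{\alpha\cdot\beta}$ and $M_\alpha\odot M_\beta=M_{\alpha\odot\beta}$ when $\alpha\odot\beta$ is defined, and $M_\alpha\odot M_\beta=0$ when the last entry of $\alpha$ and the first entry of $\beta$ are both dotted. -}

module Defs where

open import Data.Nat using (ℕ; zero; suc; NonZero; >-nonZero; >-nonZero⁻¹) renaming (_+_ to _+ℕ_)
open import Data.Nat.Properties using (<-≤-trans; m≤m+n) renaming (_≟_ to _≟ℕ_)
open import Data.Rational using (ℚ; 0ℚ; 1ℚ; _+_; _*_)
open import Data.List using (List; []; _∷_; _++_; _∷ʳ_; map; concatMap)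
open import Data.Maybe using (Maybe; just; nothing)
open import Data.Product using (Σ; _×_; _,_)
open import Data.Unit using (⊤)
open import Data.Empty using (⊥)
open import Relation.Nullary using (yes; no)
open import Relation.Binary.PropositionalEquality using (_≡_; refl; cong)
open import Relation.Binary.Definitions using (DecidableEquality)
open import Relation.Binary.Construct.Closure.ReflexiveTransitive using (Star)
import Data.List.Properties as LP

data Part : Set where
  nd  : (n : ℕ) → .{{NonZero n}} → Part
  dot : (n : ℕ) → Part

IsDotted : Part → Set
IsDotted (nd _)  = ⊥
IsDotted (dot _) = ⊤

IsNonDotted : Part → Set
IsNonDotted (nd _)  = ⊤
IsNonDotted (dot _) = ⊥

_≟P_ : DecidableEquality Part
nd m ≟P nd n with m ≟ℕ n
... | yes refl = yes refl
... | no ne = no λ { refl → ne refl }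
nd _ ≟P dot _ = no λ ()
dot _ ≟P nd _ = no λ ()
dot m ≟P dot n with m ≟ℕ n
... | yes refl = yes refl
... | no ne = no λ { refl → ne refl }

DComp : Set
DComp = List Part

_≟D_ : DecidableEquality DComp
_≟D_ = LP.≡-dec _≟P_

_+ᴾ_ : Part → Part → Maybe Part
_+ᴾ_ (nd m {{nz}}) (nd n) =
  just (nd (m +ℕ n) {{>-nonZero (<-≤-trans (>-nonZero⁻¹ m) (m≤m+n m n))}})
nd m  +ᴾ dot n = just (dot (m +ℕ n))
dot m +ᴾ nd n  = just (dot (m +ℕ n))
dot m +ᴾ dot n = nothing

near : DComp → DComp → Maybe DComp
near [] β = nothing
near (a ∷ []) [] = nothing
near (a ∷ []) (b ∷ β) = Data.Maybe.map (λ c → c ∷ β) (a +ᴾ b)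
near (a ∷ a' ∷ α) β = Data.Maybe.map (a ∷_) (near (a' ∷ α) β)

data MergeStep : DComp → DComp → Set where
  merge : (p q : DComp) (a b : ℕ) .{{na : NonZero a}} .{{nb : NonZero b}}
          (c : Part) → nd a +ᴾ nd b ≡ just c →
          MergeStep (p ++ (nd a ∷ nd b ∷ q)) (p ++ (c ∷ q))

_≼_ : DComp → DComp → Set
β ≼ α = Star MergeStep β α

-- Elements of sQSym as finite formal ℚ-linear combinations of the M_α.
SQSym : Set
SQSym = List (ℚ × DComp)

coeff : SQSym → DComp → ℚ
coeff [] γ = 0ℚ
coeff ((c , α) ∷ f) γ with α ≟D γ
... | yes _ = c + coeff f γ
... | no _  = coeff f γ

_⊕_ : SQSym → SQSym → SQSym
f ⊕ g = f ++ g

-- M_α • M_β = M_{α·β}, extended bilinearly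
_•_ : SQSym → SQSym → SQSym
f • g = concatMap (λ { (a , α) → map (λ { (b , β) → (a * b , α ++ β) }) g }) f

-- M_α ⊙ M_β = M_{α⊙β} if defined, 0 otherwise, extended bilinearly
nearTerm : ℚ × DComp → ℚ × DComp → SQSym
nearTerm (a , α) (b , β) with near α β
... | just γ  = (a * b , γ) ∷ []
... | nothing = []

_⊙_ : SQSym → SQSym → SQSym
f ⊙ g = concatMap (λ x → concatMap (nearTerm x) g) f

-- L_α = Σ_{β ≼ α} M_β, given a duplicate-free enumeration of {β | β ≼ α}.
L : (enum : DComp → List DComp) → DComp → SQSym
L enum α = map (λ β → (1ℚ , β)) (enum α)

LastNonDotted : DComp → Set
LastNonDotted α = Σ DComp λ p → Σ Part λ x → IsNonDotted x × α ≡ p ∷ʳ x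

FirstNonDotted : DComp → Set
FirstNonDotted β = Σ DComp λ q → Σ Part λ x → IsNonDotted x × β ≡ x ∷ q

{-# OPTIONS --safe #-}
-- All coefficients involved are 0 or 1, so both identities are about which pairs b₁ ≼ α, b₂ ≼ β
-- produce a given γ.  Refinement only splits non-dotted parts, so it preserves the total size and
-- the number of dotted parts; hence a refinement γ of α · β factors uniquely as b₁ · b₂, where b₁
-- is the prefix of γ with the size and dot count of α.  For α ⊙ β = αp · (a+b) · βq the
-- refinements of the merged part a+b are exactly the dotless compositions of a+b.  Cutting one at
-- size a either falls between two parts, which gives a pair for •, or strictly inside a part x+y,
-- which gives the pair for ⊙ ending in x and starting with y.  A part of γ either straddles the
-- position |α| or not, so the two cases are disjoint, and in each case the pair is unique.
module Submission where

open import Defs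
open import Data.Empty using (⊥; ⊥-elim)
open import Data.List using (List; []; _∷_; _++_; _∷ʳ_; map; concatMap; [_]; initLast; _∷ʳ′_)
import Data.List.Properties as List
open import Data.List.Membership.Propositional using (_∈_; find; lose)
open import Data.List.Membership.DecPropositional _≟D_ using (_∈?_)
import Data.List.Relation.Unary.All as All
open import Data.List.Relation.Unary.AllPairs using (_∷_)
open import Data.List.Relation.Unary.Any using (Any; here; there; toSum; fromSum)
open import Data.List.Relation.Unary.Unique.Propositional using (Unique)
open import Data.Maybe using (Maybe; just; nothing)
import Data.Maybe as Maybe
import Data.Maybe.Properties as Maybe
open import Data.Nat using (ℕ; zero; suc; _+_; _∸_; _<_; _≤_; NonZero; >-nonZero; >-nonZero⁻¹)
open import Data.Nat.ListAction using (sum)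
open import Data.Nat.ListAction.Properties using (sum-++)
open import Data.Nat.Properties
open import Data.Product using (_×_; _,_; proj₁; proj₂; ∃-syntax; ∃₂)
open import Data.Rational using (ℚ; 0ℚ; 1ℚ) renaming (_+_ to _+ℚ_; _*_ to _*ℚ_)
import Data.Rational.Properties as ℚ
open import Data.Sum using (_⊎_; inj₁; inj₂)
import Data.Sum as Sum
open import Function using (_∘_)
open import Function.Bundles using (_⇔_; mk⇔; Equivalence)
open import Relation.Binary.Construct.Closure.ReflexiveTransitive using (ε; _◅_; _◅◅_; gmap; fold)
open import Relation.Binary.PropositionalEquality hiding ([_])
open import Relation.Nullary using (¬_; Dec; yes; no)
import Relation.Nullary.Decidable as Dec

++≡++⇒overlap : ∀ {A : Set} (xs ys us vs : List A) → xs ++ ys ≡ us ++ vs →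
  (∃[ t ] us ≡ xs ++ t × ys ≡ t ++ vs) ⊎ (∃[ t ] xs ≡ us ++ t × vs ≡ t ++ ys)
++≡++⇒overlap []       ys us       vs eq = inj₁ (us , refl , eq)
++≡++⇒overlap (x ∷ xs) ys []       vs eq = inj₂ (x ∷ xs , refl , sym eq)
++≡++⇒overlap (x ∷ xs) ys (u ∷ us) vs eq with List.∷-injective eq
... | refl , eq′ with ++≡++⇒overlap xs ys us vs eq′
...   | inj₁ (t , us≡ , ys≡) = inj₁ (t , cong (x ∷_) us≡ , ys≡)
...   | inj₂ (t , xs≡ , vs≡) = inj₂ (t , cong (x ∷_) xs≡ , vs≡)

map≡just⇒ : ∀ {A B : Set} {f : A → B} (m : Maybe A) {b} → Maybe.map f m ≡ just b →
  ∃[ a ] m ≡ just a × f a ≡ b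
map≡just⇒ (just a) refl = a , refl , refl

-- Weights

partSize partDots : Part → ℕ
partSize (nd n)  = n
partSize (dot n) = n
partDots (nd _)  = 0
partDots (dot _) = 1

Additive : (Part → ℕ) → Set
Additive w = ∀ {x y c} → x +ᴾ y ≡ just c → w c ≡ w x + w y

partSize-additive : Additive partSize
partSize-additive {nd _}  {nd _}  refl = refl
partSize-additive {nd _}  {dot _} refl = refl
partSize-additive {dot _} {nd _}  refl = refl

partDots-additive : Additive partDots
partDots-additive {nd _}  {nd _}  refl = refl
partDots-additive {nd _}  {dot _} refl = refl
partDots-additive {dot _} {nd _}  refl = refl

weight : (Part → ℕ) → DComp → ℕ
weight w γ = sum (map w γ)

size dotCount : DComp → ℕ
size     = weight partSize
dotCount = weight partDots

weight-++ : ∀ w p q → weight w (p ++ q) ≡ weight w p + weight w q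
weight-++ w p q = trans (cong sum (List.map-++ w p q)) (sum-++ (map w p) (map w q))

weight-∷ʳ : ∀ w p x → weight w (p ∷ʳ x) ≡ weight w p + w x
weight-∷ʳ w p x = trans (weight-++ w p [ x ]) (cong (weight w p +_) (+-identityʳ (w x)))

nonDotted⇒size>0 : ∀ {x} → IsNonDotted x → 0 < partSize x
nonDotted⇒size>0 {nd n} _ = >-nonZero⁻¹ n

nonDotted⇒dots≡0 : ∀ {x} → IsNonDotted x → partDots x ≡ 0
nonDotted⇒dots≡0 {nd _} _ = refl

dots≡0⇒nonDotted : ∀ {x} → partDots x ≡ 0 → IsNonDotted x
dots≡0⇒nonDotted {nd _} _ = _

nonDotted-injective : ∀ {x y} → IsNonDotted x → IsNonDotted y → partSize x ≡ partSize y → x ≡ y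
nonDotted-injective {nd _} {nd _} _ _ refl = refl

weightless≡[] : ∀ t → size t ≡ 0 → dotCount t ≡ 0 → t ≡ []
weightless≡[] []          _      _ = refl
weightless≡[] (nd n ∷ t)  size≡0 _ = ⊥-elim (<-irrefl (sym (m+n≡0⇒m≡0 n size≡0)) (>-nonZero⁻¹ n))
weightless≡[] (dot _ ∷ _) _      ()

-- The refinement order

mergeStep-weight : ∀ {w} → Additive w → ∀ {γ δ} → MergeStep γ δ → weight w γ ≡ weight w δ
mergeStep-weight {w} additive (merge p q a b c a+b≡c) = begin
  weight w (p ++ nd a ∷ nd b ∷ q)                  ≡⟨ weight-++ w p _ ⟩
  weight w p + (w (nd a) + (w (nd b) + weight w q)) ≡⟨ cong (weight w p +_) (+-assoc (w (nd a)) _ _) ⟨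
  weight w p + ((w (nd a) + w (nd b)) + weight w q)
    ≡⟨ cong (λ k → weight w p + (k + weight w q)) (additive a+b≡c) ⟨
  weight w p + (w c + weight w q)                   ≡⟨ weight-++ w p _ ⟨
  weight w (p ++ c ∷ q)                             ∎
  where open ≡-Reasoning

≼-weight : ∀ {w} → Additive w → ∀ {γ δ} → γ ≼ δ → weight w γ ≡ weight w δ
≼-weight {w} additive = fold (λ γ δ → weight w γ ≡ weight w δ) (trans ∘ mergeStep-weight additive) refl

mergeStep-++ʳ : ∀ {γ δ} → MergeStep γ δ → ∀ r → MergeStep (γ ++ r) (δ ++ r)
mergeStep-++ʳ (merge p q a b c e) r =
  subst₂ MergeStep (sym (List.++-assoc p (nd a ∷ nd b ∷ q) r)) (sym (List.++-assoc p (c ∷ q) r))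
    (merge p (q ++ r) a b c e)

mergeStep-++ˡ : ∀ l {γ δ} → MergeStep γ δ → MergeStep (l ++ γ) (l ++ δ)
mergeStep-++ˡ l (merge p q a b c e) =
  subst₂ MergeStep (List.++-assoc l p (nd a ∷ nd b ∷ q)) (List.++-assoc l p (c ∷ q))
    (merge (l ++ p) q a b c e)

≼-++ : ∀ {γ δ γ′ δ′} → γ ≼ δ → γ′ ≼ δ′ → (γ ++ γ′) ≼ (δ ++ δ′)
≼-++ {δ = δ} {γ′ = γ′} γ≼δ γ′≼δ′ =
  gmap (_++ γ′) (λ s → mergeStep-++ʳ s γ′) γ≼δ ◅◅ gmap (δ ++_) (mergeStep-++ˡ δ) γ′≼δ′

Junction : Set₁
Junction = DComp → DComp → DComp → Set

Concatenation NearConcatenation : Junction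
Concatenation     b₁ b₂ γ = γ ≡ b₁ ++ b₂
NearConcatenation b₁ b₂ γ = near b₁ b₂ ≡ just γ

RefinedJoin : Junction → DComp → DComp → DComp → Set
RefinedJoin R α β γ = ∃₂ λ b₁ b₂ → b₁ ≼ α × b₂ ≼ β × R b₁ b₂ γ

mergeStep-++⁻ : ∀ {γ δ} b₁ b₂ → MergeStep γ δ → δ ≡ b₁ ++ b₂ → RefinedJoin Concatenation b₁ b₂ γ
mergeStep-++⁻ b₁ b₂ (merge p q a b c e) eq with ++≡++⇒overlap p (c ∷ q) b₁ b₂ eq
... | inj₁ ([] , refl , refl) =
  p , nd a ∷ nd b ∷ q , subst (p ≼_) (sym (List.++-identityʳ p)) ε , merge [] q a b c e ◅ ε , refl
... | inj₁ (c ∷ t , refl , refl) =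
  p ++ nd a ∷ nd b ∷ t , b₂ , merge p t a b c e ◅ ε , ε , sym (List.++-assoc p (nd a ∷ nd b ∷ t) b₂)
... | inj₂ (t , refl , refl) =
  b₁ , t ++ nd a ∷ nd b ∷ q , ε , merge t q a b c e ◅ ε , List.++-assoc b₁ t (nd a ∷ nd b ∷ q)

≼-++⁻ : ∀ {γ} α β → γ ≼ (α ++ β) → RefinedJoin Concatenation α β γ
≼-++⁻ α β γ≼α++β = split γ≼α++β refl
  where
  split : ∀ {γ δ} → γ ≼ δ → δ ≡ α ++ β → RefinedJoin Concatenation α β γ
  split ε refl = α , β , ε , ε , refl
  split (s ◅ r) eq with split r eq
  ... | b₁ , b₂ , b₁≼α , b₂≼β , refl with mergeStep-++⁻ b₁ b₂ s refl
  ...   | c₁ , c₂ , c₁≼b₁ , c₂≼b₂ , γ≡ = c₁ , c₂ , c₁≼b₁ ◅◅ b₁≼α , c₂≼b₂ ◅◅ b₂≼β , γ≡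

refinedConcatenation⇔≼-++ : ∀ α β {γ} → RefinedJoin Concatenation α β γ ⇔ γ ≼ (α ++ β)
refinedConcatenation⇔≼-++ α β = mk⇔ (λ { (_ , _ , b₁≼α , b₂≼β , refl) → ≼-++ b₁≼α b₂≼β }) (≼-++⁻ α β)

≼-singleton⁻ : ∀ {x κ} → IsNonDotted x → κ ≼ [ x ] → dotCount κ ≡ 0 × size κ ≡ partSize x
≼-singleton⁻ x-nd κ≼x =
  trans (≼-weight partDots-additive κ≼x) (trans (+-identityʳ _) (nonDotted⇒dots≡0 x-nd)) ,
  trans (≼-weight partSize-additive κ≼x) (+-identityʳ _)

≼-singleton⁺ : ∀ κ {x} → IsNonDotted x → dotCount κ ≡ 0 → size κ ≡ partSize x → κ ≼ [ x ]
≼-singleton⁺ [] x-nd _ size≡ = ⊥-elim (<-irrefl size≡ (nonDotted⇒size>0 x-nd))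
≼-singleton⁺ (nd m ∷ []) x-nd _ size≡ =
  subst (λ z → [ nd m ] ≼ [ z ]) (nonDotted-injective _ x-nd (trans (sym (+-identityʳ m)) size≡)) ε
≼-singleton⁺ (nd m ∷ z ∷ κ) x-nd dotless size≡ =
  subst (λ y → (nd m ∷ z ∷ κ) ≼ [ y ]) (nonDotted-injective _ x-nd size≡)
    (≼-++ {γ = [ nd m ]} ε (≼-singleton⁺ (z ∷ κ) _ dotless refl) ◅◅ merge [] [] m _ {{_}} {{nz}} _ refl ◅ ε)
  where
  nz : NonZero (size (z ∷ κ))
  nz = >-nonZero (<-≤-trans (nonDotted⇒size>0 {z} (dots≡0⇒nonDotted (m+n≡0⇒m≡0 _ dotless)))
                            (m≤m+n _ (size κ)))
≼-singleton⁺ (dot _ ∷ _) _ () _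

≼-nonDotted-singleton⇒≢[] : ∀ {x κ} → IsNonDotted x → κ ≼ [ x ] → κ ≢ []
≼-nonDotted-singleton⇒≢[] x-nd κ≼x refl = <-irrefl (proj₂ (≼-singleton⁻ x-nd κ≼x)) (nonDotted⇒size>0 x-nd)

≼-lastNonDotted : ∀ {α β} → LastNonDotted α → β ≼ α → LastNonDotted β
≼-lastNonDotted (αp , a , a-nd , refl) β≼α with ≼-++⁻ αp [ a ] β≼α
... | β₁ , κ , _ , κ≼a , refl with initLast κ
...   | []      = ⊥-elim (≼-nonDotted-singleton⇒≢[] a-nd κ≼a refl)
...   | ν ∷ʳ′ z = β₁ ++ ν , z , z-nd , sym (List.++-assoc β₁ ν [ z ])
  where
  z-nd : IsNonDotted z
  z-nd = dots≡0⇒nonDotted (m+n≡0⇒n≡0 (dotCount ν)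
           (trans (sym (weight-∷ʳ partDots ν z)) (proj₁ (≼-singleton⁻ a-nd κ≼a))))

≼-firstNonDotted : ∀ {α β} → FirstNonDotted α → β ≼ α → FirstNonDotted β
≼-firstNonDotted (αq , a , a-nd , refl) β≼α with ≼-++⁻ [ a ] αq β≼α
... | [] , _ , κ≼a , _ , refl = ⊥-elim (≼-nonDotted-singleton⇒≢[] a-nd κ≼a refl)
... | z ∷ ν , β₂ , κ≼a , _ , refl =
  ν ++ β₂ , z , dots≡0⇒nonDotted (m+n≡0⇒m≡0 _ (proj₁ (≼-singleton⁻ a-nd κ≼a))) , refl

-- Near concatenation

near-∷ : ∀ {κ} x κ₁ κ₂ → near κ₁ κ₂ ≡ just κ → near (x ∷ κ₁) κ₂ ≡ just (x ∷ κ)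
near-∷ x []      _ ()
near-∷ x (_ ∷ _) _ eq = cong (Maybe.map (x ∷_)) eq

near-∷ˡ : ∀ x {ζ} β → ζ ≢ [] → near (x ∷ ζ) β ≡ Maybe.map (x ∷_) (near ζ β)
near-∷ˡ x {[]}    β ζ≢[] = ⊥-elim (ζ≢[] refl)
near-∷ˡ x {_ ∷ _} β _    = refl

near-++ˡ : ∀ p {κ} β → κ ≢ [] → near (p ++ κ) β ≡ Maybe.map (p ++_) (near κ β)
near-++ˡ []      {κ} β _    = sym (Maybe.map-id (near κ β))
near-++ˡ (x ∷ p) {κ} β κ≢[] = begin
  near (x ∷ p ++ κ) β                              ≡⟨ near-∷ˡ x β (κ≢[] ∘ List.++-conicalʳ p κ) ⟩
  Maybe.map (x ∷_) (near (p ++ κ) β)               ≡⟨ cong (Maybe.map (x ∷_)) (near-++ˡ p β κ≢[]) ⟩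
  Maybe.map (x ∷_) (Maybe.map (p ++_) (near κ β))  ≡⟨ Maybe.map-∘ (near κ β) ⟨
  Maybe.map ((x ∷ p) ++_) (near κ β)               ∎
  where open ≡-Reasoning

near-++ʳ : ∀ α {κ} q → κ ≢ [] → near α (κ ++ q) ≡ Maybe.map (_++ q) (near α κ)
near-++ʳ []           q _    = refl
near-++ʳ (x ∷ [])     {[]}    q κ≢[] = ⊥-elim (κ≢[] refl)
near-++ʳ (x ∷ [])     {y ∷ κ} q _    = Maybe.map-∘ {g = _++ q} {f = _∷ κ} (x +ᴾ y)
near-++ʳ (x ∷ x′ ∷ α) {κ}     q κ≢[] = begin
  Maybe.map (x ∷_) (near (x′ ∷ α) (κ ++ q))                 ≡⟨ cong (Maybe.map (x ∷_)) (near-++ʳ (x′ ∷ α) q κ≢[]) ⟩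
  Maybe.map (x ∷_) (Maybe.map (_++ q) (near (x′ ∷ α) κ))   ≡⟨ Maybe.map-∘ (near (x′ ∷ α) κ) ⟨
  Maybe.map (λ ζ → x ∷ ζ ++ q) (near (x′ ∷ α) κ)            ≡⟨ Maybe.map-∘ (near (x′ ∷ α) κ) ⟩
  Maybe.map (_++ q) (Maybe.map (x ∷_) (near (x′ ∷ α) κ))   ∎
  where open ≡-Reasoning

near-++ : ∀ p {κ₁ κ₂} q → κ₁ ≢ [] → κ₂ ≢ [] →
  near (p ++ κ₁) (κ₂ ++ q) ≡ Maybe.map (λ κ → p ++ κ ++ q) (near κ₁ κ₂)
near-++ p {κ₁} {κ₂} q κ₁≢[] κ₂≢[] = begin
  near (p ++ κ₁) (κ₂ ++ q)                              ≡⟨ near-++ˡ p (κ₂ ++ q) κ₁≢[] ⟩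
  Maybe.map (p ++_) (near κ₁ (κ₂ ++ q))                 ≡⟨ cong (Maybe.map (p ++_)) (near-++ʳ κ₁ q κ₂≢[]) ⟩
  Maybe.map (p ++_) (Maybe.map (_++ q) (near κ₁ κ₂))   ≡⟨ Maybe.map-∘ (near κ₁ κ₂) ⟨
  Maybe.map (λ κ → p ++ κ ++ q) (near κ₁ κ₂)            ∎
  where open ≡-Reasoning

near-∷ʳ⁻ : ∀ P x y Q {γ} → near (P ∷ʳ x) (y ∷ Q) ≡ just γ → ∃[ c ] x +ᴾ y ≡ just c × γ ≡ P ++ c ∷ Q
near-∷ʳ⁻ P x y Q eq with map≡just⇒ (near [ x ] (y ∷ Q)) (trans (sym (near-++ˡ P (y ∷ Q) (λ ()))) eq)
... | _ , x⊙y≡ , refl with map≡just⇒ (x +ᴾ y) x⊙y≡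
...   | c , x+y≡c , refl = c , x+y≡c , refl

near-weight : ∀ {w} → Additive w → ∀ α β {γ} → near α β ≡ just γ → weight w γ ≡ weight w α + weight w β
near-weight additive []  _ ()
near-weight additive (x ∷ []) [] ()
near-weight {w} additive (x ∷ []) (y ∷ β) eq with map≡just⇒ (x +ᴾ y) eq
... | c , x+y≡c , refl = begin
  w c + weight w β               ≡⟨ cong (_+ weight w β) (additive x+y≡c) ⟩
  (w x + w y) + weight w β       ≡⟨ +-assoc (w x) _ _ ⟩
  w x + (w y + weight w β)       ≡⟨ cong (_+ (w y + weight w β)) (+-identityʳ (w x)) ⟨
  (w x + 0) + (w y + weight w β) ∎
  where open ≡-Reasoning
near-weight {w} additive (x ∷ x′ ∷ α) β eq with map≡just⇒ (near (x′ ∷ α) β) eq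
... | _ , eq′ , refl =
  trans (cong (w x +_) (near-weight additive (x′ ∷ α) β eq′)) (sym (+-assoc (w x) _ _))

WeightAdditive : Junction → Set
WeightAdditive R = ∀ {w} → Additive w → ∀ {b₁ b₂ γ} → R b₁ b₂ γ → weight w γ ≡ weight w b₁ + weight w b₂

concatenation-additive : WeightAdditive Concatenation
concatenation-additive {w} _ {b₁} {b₂} refl = weight-++ w b₁ b₂

nearConcatenation-additive : WeightAdditive NearConcatenation
nearConcatenation-additive additive {b₁} {b₂} = near-weight additive b₁ b₂

nd-cong : ∀ {m n} .{{_ : NonZero m}} .{{_ : NonZero n}} → m ≡ n → nd m ≡ nd n
nd-cong refl = refl

-- Refinements of a merged part

SplitAt : Junction → ℕ → DComp → Set
SplitAt R m κ = ∃₂ λ κ₁ κ₂ → R κ₁ κ₂ κ × size κ₁ ≡ m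

cut : ∀ κ m → dotCount κ ≡ 0 → m ≤ size κ → SplitAt Concatenation m κ ⊎ SplitAt NearConcatenation m κ
cut []          m       _       m≤0 = inj₁ ([] , [] , refl , sym (n≤0⇒n≡0 m≤0))
cut (dot _ ∷ _) _       ()      _
cut (nd k ∷ κ)  zero    _       _   = inj₁ ([] , nd k ∷ κ , refl , refl)
cut (nd k ∷ κ)  (suc m) dotless m≤  with suc m <? k
... | yes m<k = inj₂ ([ nd (suc m) ] , nd (k ∸ suc m) {{>-nonZero (m<n⇒0<n∸m m<k)}} ∷ κ ,
                      cong (λ c → just (c ∷ κ)) (nd-cong {{_}} {{_}} (m+[n∸m]≡n (<⇒≤ m<k))) ,
                      +-identityʳ (suc m))
... | no m≮k  = Sum.map (prepend {Concatenation} (λ _ _ → cong (nd k ∷_)))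
                        (prepend {NearConcatenation} (near-∷ (nd k)))
                        (cut κ (suc m ∸ k) dotless (m≤n+o⇒m∸n≤o (suc m) k m≤))
  where
  prepend : ∀ {R} → (∀ κ₁ κ₂ → R κ₁ κ₂ κ → R (nd k ∷ κ₁) κ₂ (nd k ∷ κ)) →
    SplitAt R (suc m ∸ k) κ → SplitAt R (suc m) (nd k ∷ κ)
  prepend extend (κ₁ , κ₂ , join , size≡) =
    nd k ∷ κ₁ , κ₂ , extend κ₁ κ₂ join , trans (cong (k +_) size≡) (m+[n∸m]≡n (≮⇒≥ m≮k))

concatenation≼merged : ∀ αp βq {a b c} → IsNonDotted a → IsNonDotted b → a +ᴾ b ≡ just c →
  ((αp ∷ʳ a) ++ (b ∷ βq)) ≼ (αp ++ c ∷ βq)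
concatenation≼merged αp βq {nd m} {nd n} {c} _ _ m+n≡c =
  subst (_≼ (αp ++ c ∷ βq)) (sym (List.++-assoc αp [ nd m ] (nd n ∷ βq))) (merge αp βq m n c m+n≡c ◅ ε)

module _ {a b c : Part} (a-nd : IsNonDotted a) (b-nd : IsNonDotted b) (a+b≡c : a +ᴾ b ≡ just c) where

  private
    c-nd : IsNonDotted c
    c-nd = dots≡0⇒nonDotted
      (trans (partDots-additive a+b≡c) (cong₂ _+_ (nonDotted⇒dots≡0 a-nd) (nonDotted⇒dots≡0 b-nd)))

  refinedJoin⇒≼-mergedPart : ∀ {R κ} → WeightAdditive R → RefinedJoin R [ a ] [ b ] κ → κ ≼ [ c ]
  refinedJoin⇒≼-mergedPart R-additive (κ₁ , κ₂ , κ₁≼a , κ₂≼b , join)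
    with ≼-singleton⁻ a-nd κ₁≼a | ≼-singleton⁻ b-nd κ₂≼b
  ... | dotless₁ , size₁ | dotless₂ , size₂ = ≼-singleton⁺ _ c-nd
    (trans (R-additive partDots-additive join) (cong₂ _+_ dotless₁ dotless₂))
    (trans (R-additive partSize-additive join)
           (trans (cong₂ _+_ size₁ size₂) (sym (partSize-additive a+b≡c))))

  refinedJoin-atSize : ∀ {R κ₁ κ₂ κ} → WeightAdditive R → κ ≼ [ c ] → R κ₁ κ₂ κ → size κ₁ ≡ partSize a →
    RefinedJoin R [ a ] [ b ] κ
  refinedJoin-atSize {κ₁ = κ₁} {κ₂} R-additive κ≼c join size₁ with ≼-singleton⁻ c-nd κ≼c
  ... | dotless , size≡ = κ₁ , κ₂ ,
    ≼-singleton⁺ κ₁ a-nd (m+n≡0⇒m≡0 _ dotless₁₂) size₁ ,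
    ≼-singleton⁺ κ₂ b-nd (m+n≡0⇒n≡0 (dotCount κ₁) dotless₁₂) (+-cancelˡ-≡ (partSize a) _ _ size₁₂) ,
    join
    where
    dotless₁₂ : dotCount κ₁ + dotCount κ₂ ≡ 0
    dotless₁₂ = trans (sym (R-additive partDots-additive join)) dotless
    size₁₂ : partSize a + size κ₂ ≡ partSize a + partSize b
    size₁₂ = begin
      partSize a + size κ₂  ≡⟨ cong (_+ size κ₂) size₁ ⟨
      size κ₁ + size κ₂     ≡⟨ R-additive partSize-additive join ⟨
      _                     ≡⟨ size≡ ⟩
      partSize c            ≡⟨ partSize-additive a+b≡c ⟩
      partSize a + partSize b ∎
      where open ≡-Reasoning

  ≼-mergedPart⇒refinedJoin : ∀ {κ} → κ ≼ [ c ] →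
    RefinedJoin Concatenation [ a ] [ b ] κ ⊎ RefinedJoin NearConcatenation [ a ] [ b ] κ
  ≼-mergedPart⇒refinedJoin {κ} κ≼c with ≼-singleton⁻ c-nd κ≼c
  ... | dotless , size≡ with cut κ (partSize a) dotless (subst (partSize a ≤_) a+b≡size (m≤m+n _ _))
    where
    a+b≡size : partSize a + partSize b ≡ size κ
    a+b≡size = sym (trans size≡ (partSize-additive a+b≡c))
  ... | inj₁ (κ₁ , κ₂ , join , size₁) =
    inj₁ (refinedJoin-atSize {κ₁ = κ₁} {κ₂} concatenation-additive κ≼c join size₁)
  ... | inj₂ (κ₁ , κ₂ , join , size₁) =
    inj₂ (refinedJoin-atSize {κ₁ = κ₁} {κ₂} nearConcatenation-additive κ≼c join size₁)

  private
    near-lift : ∀ γp γq {κ₁ κ₂} → κ₁ ≼ [ a ] → κ₂ ≼ [ b ] →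
      near (γp ++ κ₁) (κ₂ ++ γq) ≡ Maybe.map (λ κ → γp ++ κ ++ γq) (near κ₁ κ₂)
    near-lift γp γq κ₁≼a κ₂≼b =
      near-++ γp γq (≼-nonDotted-singleton⇒≢[] a-nd κ₁≼a) (≼-nonDotted-singleton⇒≢[] b-nd κ₂≼b)

  module _ (αp βq : DComp) where

    ≼-merged⇒ : ∀ {γ} → γ ≼ (αp ++ c ∷ βq) →
      RefinedJoin Concatenation (αp ∷ʳ a) (b ∷ βq) γ ⊎ RefinedJoin NearConcatenation (αp ∷ʳ a) (b ∷ βq) γ
    ≼-merged⇒ γ≼ with ≼-++⁻ αp (c ∷ βq) γ≼
    ... | γp , _ , γp≼ , rest≼ , refl with ≼-++⁻ [ c ] βq rest≼
    ... | κ , γq , κ≼c , γq≼ , refl with ≼-mergedPart⇒refinedJoin κ≼c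
    ... | inj₁ (κ₁ , κ₂ , κ₁≼a , κ₂≼b , refl) =
      inj₁ (γp ++ κ₁ , κ₂ ++ γq , ≼-++ γp≼ κ₁≼a , ≼-++ κ₂≼b γq≼ ,
            trans (cong (γp ++_) (List.++-assoc κ₁ κ₂ γq)) (sym (List.++-assoc γp κ₁ (κ₂ ++ γq))))
    ... | inj₂ (κ₁ , κ₂ , κ₁≼a , κ₂≼b , join) =
      inj₂ (γp ++ κ₁ , κ₂ ++ γq , ≼-++ γp≼ κ₁≼a , ≼-++ κ₂≼b γq≼ ,
            trans (near-lift γp γq κ₁≼a κ₂≼b) (cong (Maybe.map (λ κ → γp ++ κ ++ γq)) join))

    ≼-merged⇐ : ∀ {γ} →
      RefinedJoin Concatenation (αp ∷ʳ a) (b ∷ βq) γ ⊎ RefinedJoin NearConcatenation (αp ∷ʳ a) (b ∷ βq) γ →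
      γ ≼ (αp ++ c ∷ βq)
    ≼-merged⇐ (inj₁ (_ , _ , b₁≼ , b₂≼ , refl)) = ≼-++ b₁≼ b₂≼ ◅◅ concatenation≼merged αp βq a-nd b-nd a+b≡c
    ≼-merged⇐ (inj₂ (_ , _ , b₁≼ , b₂≼ , join)) with ≼-++⁻ αp [ a ] b₁≼ | ≼-++⁻ [ b ] βq b₂≼
    ... | γp , κ₁ , γp≼ , κ₁≼a , refl | κ₂ , γq , κ₂≼b , γq≼ , refl
      with map≡just⇒ (near κ₁ κ₂) (trans (sym (near-lift γp γq κ₁≼a κ₂≼b)) join)
    ... | κ , κ-join , refl =
      ≼-++ γp≼ (≼-++ (refinedJoin⇒≼-mergedPart nearConcatenation-additive (κ₁ , κ₂ , κ₁≼a , κ₂≼b , κ-join))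
                     γq≼)

refinedJoins⇔≼-near : ∀ {α β δ γ} → LastNonDotted α → FirstNonDotted β → near α β ≡ just δ →
  (RefinedJoin Concatenation α β γ ⊎ RefinedJoin NearConcatenation α β γ) ⇔ γ ≼ δ
refinedJoins⇔≼-near (αp , a , a-nd , refl) (βq , b , b-nd , refl) α⊙β≡δ with near-∷ʳ⁻ αp a b βq α⊙β≡δ
... | c , a+b≡c , refl = mk⇔ (≼-merged⇐ a-nd b-nd a+b≡c αp βq) (≼-merged⇒ a-nd b-nd a+b≡c αp βq)

-- Uniqueness of the factorisations

size-prefix : ∀ ν t → size ν ≤ size (ν ++ t)
size-prefix ν t = subst (size ν ≤_) (sym (weight-++ partSize ν t)) (m≤m+n _ _)

part-boundary : ∀ ν μ P c Q → ν ++ μ ≡ P ++ c ∷ Q → size ν < size P + partSize c → ∃[ t ] P ≡ ν ++ t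
part-boundary ν μ P c Q eq ν<Pc with ++≡++⇒overlap ν μ P (c ∷ Q) eq
... | inj₁ (t , P≡ , _) = t , P≡
... | inj₂ ([] , ν≡ , _) = [] , trans (sym (List.++-identityʳ P)) (trans (sym ν≡) (sym (List.++-identityʳ ν)))
... | inj₂ (c′ ∷ t , refl , c∷Q≡) with List.∷-injective c∷Q≡
...   | refl , _ = ⊥-elim (<⇒≱ ν<Pc (subst (size P + partSize c ≤_) (sym (weight-++ partSize P (c ∷ t)))
                                         (+-monoʳ-≤ (size P) (m≤m+n _ _))))

straddle-no-boundary : ∀ {ν μ P c Q} → ν ++ μ ≡ P ++ c ∷ Q →
  size P < size ν → size ν < size P + partSize c → ⊥
straddle-no-boundary {ν} {μ} {P} {c} {Q} eq P<ν ν<Pc with part-boundary ν μ P c Q eq ν<Pc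
... | t , refl = <⇒≱ P<ν (size-prefix ν t)

straddle-unique : ∀ {n P c Q P′ c′ Q′} → P ++ c ∷ Q ≡ P′ ++ c′ ∷ Q′ →
  size P < n → n < size P + partSize c → size P′ < n → n < size P′ + partSize c′ → P ≡ P′
straddle-unique {n} {P} {c} {Q} {P′} {c′} {Q′} eq P<n n<Pc P′<n n<P′c′
  with part-boundary P′ (c′ ∷ Q′) P c Q (sym eq) (<-trans P′<n n<Pc)
     | part-boundary P (c ∷ Q) P′ c′ Q′ eq (<-trans P<n n<P′c′)
... | t , refl | t′ , P′≡ = trans (cong (P′ ++_) t≡[]) (List.++-identityʳ P′)
  where
  t≡[] : t ≡ []
  t≡[] = List.++-conicalˡ t t′ (List.++-identityʳ-unique P′ (trans P′≡ (List.++-assoc P′ t t′)))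

trivial-extension : ∀ p t → size (p ++ t) ≡ size p → dotCount (p ++ t) ≡ dotCount p → t ≡ []
trivial-extension p t size≡ dots≡ = weightless≡[] t (cancel partSize size≡) (cancel partDots dots≡)
  where
  cancel : ∀ w → weight w (p ++ t) ≡ weight w p → weight w t ≡ 0
  cancel w e = +-cancelˡ-≡ (weight w p) _ _ (trans (sym (weight-++ w p t)) (trans e (sym (+-identityʳ _))))

equal-weight-prefix : ∀ {b₁ b₂ b₁′ b₂′} → b₁ ++ b₂ ≡ b₁′ ++ b₂′ →
  size b₁ ≡ size b₁′ → dotCount b₁ ≡ dotCount b₁′ → b₁ ≡ b₁′
equal-weight-prefix {b₁} {b₂} {b₁′} {b₂′} eq size≡ dots≡ with ++≡++⇒overlap b₁ b₂ b₁′ b₂′ eq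
... | inj₁ (t , refl , _) =
  sym (trans (cong (b₁ ++_) (trivial-extension b₁ t (sym size≡) (sym dots≡))) (List.++-identityʳ b₁))
... | inj₂ (t , refl , _) =
  trans (cong (b₁′ ++_) (trivial-extension b₁′ t size≡ dots≡)) (List.++-identityʳ b₁′)

≼-sameWeight : ∀ {w} → Additive w → ∀ {b b′ α} → b ≼ α → b′ ≼ α → weight w b ≡ weight w b′
≼-sameWeight additive b≼α b′≼α = trans (≼-weight additive b≼α) (sym (≼-weight additive b′≼α))

PairsUnique : Junction → DComp → DComp → DComp → Set
PairsUnique R α β γ = ∀ {b₁ b₂ b₁′ b₂′} → b₁ ≼ α → b₂ ≼ β → b₁′ ≼ α → b₂′ ≼ β →
  R b₁ b₂ γ → R b₁′ b₂′ γ → b₁ ≡ b₁′ × b₂ ≡ b₂′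

concatenation-pairs-unique : ∀ {α β γ} → PairsUnique Concatenation α β γ
concatenation-pairs-unique {b₁ = b₁} {b₂} {b₁′} {b₂′} b₁≼α _ b₁′≼α _ γ≡ γ≡′
  with equal-weight-prefix {b₁} {b₂} {b₁′} {b₂′} (trans (sym γ≡) γ≡′)
         (≼-sameWeight partSize-additive b₁≼α b₁′≼α) (≼-sameWeight partDots-additive b₁≼α b₁′≼α)
... | refl = refl , List.++-cancelˡ b₁ _ _ (trans (sym γ≡) γ≡′)

record NearSplit (b₁ b₂ γ : DComp) : Set where
  constructor nearSplit
  field
    init tail         : DComp
    left right joint  : Part
    left-nd           : IsNonDotted left
    right-nd          : IsNonDotted right
    left+right≡joint  : left +ᴾ right ≡ just joint
    b₁≡               : b₁ ≡ init ∷ʳ left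
    b₂≡               : b₂ ≡ right ∷ tail
    γ≡                : γ ≡ init ++ joint ∷ tail

nearSplit-straddles : ∀ {b₁ b₂ γ} (s : NearSplit b₁ b₂ γ) →
  size (NearSplit.init s) < size b₁ × size b₁ < size (NearSplit.init s) + partSize (NearSplit.joint s)
nearSplit-straddles (nearSplit P _ x y _ x-nd y-nd x+y≡c refl refl _) =
  subst (size P <_) (sym (weight-∷ʳ partSize P x)) (m<m+n _ (nonDotted⇒size>0 x-nd)) ,
  subst₂ _<_ (sym (weight-∷ʳ partSize P x)) (cong (size P +_) (sym (partSize-additive x+y≡c)))
    (+-monoʳ-< (size P) (m<m+n _ (nonDotted⇒size>0 y-nd)))

nearSplit-unique : ∀ {b₁ b₂ b₁′ b₂′ γ} → NearSplit b₁ b₂ γ → NearSplit b₁′ b₂′ γ → size b₁ ≡ size b₁′ →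
  b₁ ≡ b₁′ × b₂ ≡ b₂′
nearSplit-unique s@(nearSplit P Q x y c x-nd y-nd x+y≡c refl refl refl)
                 s′@(nearSplit P′ Q′ x′ y′ c′ x′-nd y′-nd x′+y′≡c′ refl refl γ≡) size≡
  with straddle-unique γ≡ (proj₁ (nearSplit-straddles s)) (proj₂ (nearSplit-straddles s))
         (subst (size P′ <_) (sym size≡) (proj₁ (nearSplit-straddles s′)))
         (subst (_< size P′ + partSize c′) (sym size≡) (proj₂ (nearSplit-straddles s′)))
... | refl with List.∷-injective (List.++-cancelˡ P _ _ γ≡)
...   | refl , refl = cong (P ∷ʳ_) x≡x′ , cong (_∷ Q) y≡y′
  where
  x≡x′ : x ≡ x′
  x≡x′ = nonDotted-injective x-nd x′-nd (+-cancelˡ-≡ (size P) _ _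
           (trans (sym (weight-∷ʳ partSize P x)) (trans size≡ (weight-∷ʳ partSize P x′))))
  y≡y′ : y ≡ y′
  y≡y′ = nonDotted-injective y-nd y′-nd (+-cancelˡ-≡ (partSize x) _ _
           (trans (sym (partSize-additive x+y≡c))
             (trans (partSize-additive x′+y′≡c′) (cong (λ z → partSize z + partSize y′) (sym x≡x′)))))

module _ {α β : DComp} (lastα : LastNonDotted α) (firstβ : FirstNonDotted β) where

  nearSplit-≼ : ∀ {b₁ b₂ γ} → b₁ ≼ α → b₂ ≼ β → NearConcatenation b₁ b₂ γ → NearSplit b₁ b₂ γ
  nearSplit-≼ b₁≼α b₂≼β join with ≼-lastNonDotted lastα b₁≼α | ≼-firstNonDotted firstβ b₂≼β
  ... | P , x , x-nd , refl | Q , y , y-nd , refl with near-∷ʳ⁻ P x y Q join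
  ... | c , x+y≡c , γ≡ = nearSplit P Q x y c x-nd y-nd x+y≡c refl refl γ≡

  nearConcatenation-pairs-unique : ∀ {γ} → PairsUnique NearConcatenation α β γ
  nearConcatenation-pairs-unique b₁≼α b₂≼β b₁′≼α b₂′≼β join join′ =
    nearSplit-unique (nearSplit-≼ b₁≼α b₂≼β join) (nearSplit-≼ b₁′≼α b₂′≼β join′)
      (≼-sameWeight partSize-additive b₁≼α b₁′≼α)

  concatenation-near-disjoint : ∀ {γ} →
    RefinedJoin Concatenation α β γ → RefinedJoin NearConcatenation α β γ → ⊥
  concatenation-near-disjoint (b₁ , b₂ , b₁≼α , _ , refl) (b₁′ , _ , b₁′≼α , b₂′≼β , join)
    with nearSplit-≼ b₁′≼α b₂′≼β join
  ... | s@(nearSplit P _ _ _ c _ _ _ _ _ γ≡) =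
    straddle-no-boundary {b₁} {b₂} γ≡ (subst (size P <_) size≡ (proj₁ (nearSplit-straddles s)))
                                      (subst (_< size P + partSize c) size≡ (proj₂ (nearSplit-straddles s)))
    where
    size≡ : size b₁′ ≡ size b₁
    size≡ = ≼-sameWeight partSize-additive b₁′≼α b₁≼α

-- Coefficients

_indicates_ : ℚ → Set → Set
q indicates P = (P → q ≡ 1ℚ) × (¬ P → q ≡ 0ℚ)

indicates-⇔ : ∀ {q P Q} → q indicates P → P ⇔ Q → q indicates Q
indicates-⇔ (q₁ , q₀) P⇔Q = q₁ ∘ Equivalence.from P⇔Q , λ ¬Q → q₀ (¬Q ∘ Equivalence.to P⇔Q)

indicates-+ : ∀ {q r P Q} → q indicates P → r indicates Q → (P → Q → ⊥) → (q +ℚ r) indicates (P ⊎ Q)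
indicates-+ (q₁ , q₀) (r₁ , r₀) disjoint =
  (λ { (inj₁ p) → trans (cong₂ _+ℚ_ (q₁ p) (r₀ (disjoint p))) (ℚ.+-identityʳ 1ℚ)
     ; (inj₂ p) → trans (cong₂ _+ℚ_ (q₀ (λ p′ → disjoint p′ p)) (r₁ p)) (ℚ.+-identityˡ 1ℚ) }) ,
  λ ¬P⊎Q → trans (cong₂ _+ℚ_ (q₀ (¬P⊎Q ∘ inj₁)) (r₀ (¬P⊎Q ∘ inj₂))) (ℚ.+-identityˡ 0ℚ)

indicates-unique : ∀ {q r P} → q indicates P → r indicates P → Dec P → q ≡ r
indicates-unique (q₁ , _) (r₁ , _) (yes p) = trans (q₁ p) (sym (r₁ p))
indicates-unique (_ , q₀) (_ , r₀) (no ¬p) = trans (q₀ ¬p) (sym (r₀ ¬p))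

coeff-++ : ∀ f g γ → coeff (f ++ g) γ ≡ coeff f γ +ℚ coeff g γ
coeff-++ [] g γ = sym (ℚ.+-identityˡ _)
coeff-++ ((c , α) ∷ f) g γ with α ≟D γ
... | yes _ = trans (cong (c +ℚ_) (coeff-++ f g γ)) (sym (ℚ.+-assoc c _ _))
... | no _  = coeff-++ f g γ

coeff-singleton : ∀ {c β γ} → c ≡ 1ℚ → coeff [ (c , β) ] γ indicates (γ ≡ β)
coeff-singleton {β = β} {γ} refl with β ≟D γ
... | yes β≡γ = (λ _ → ℚ.+-identityʳ 1ℚ) , λ γ≢β → ⊥-elim (γ≢β (sym β≡γ))
... | no β≢γ  = (λ γ≡β → ⊥-elim (β≢γ (sym γ≡β))) , λ _ → refl

coeff-concatMap : ∀ {A : Set} {Q : A → Set} {γ} (h : A → SQSym) {xs} → Unique xs →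
  (∀ {x} → x ∈ xs → coeff (h x) γ indicates Q x) →
  (∀ {x y} → x ∈ xs → y ∈ xs → Q x → Q y → x ≡ y) →
  coeff (concatMap h xs) γ indicates Any Q xs
coeff-concatMap h {[]} _ _ _ = (λ ()) , λ _ → refl
coeff-concatMap {Q = Q} {γ} h {x ∷ xs} (x∉xs ∷ xs-unique) indicator atMostOnce =
  subst (_indicates Any Q (x ∷ xs)) (sym (coeff-++ (h x) (concatMap h xs) γ))
    (indicates-⇔ (indicates-+ (indicator (here refl)) rest disjoint) (mk⇔ fromSum toSum))
  where
  rest : coeff (concatMap h xs) γ indicates Any Q xs
  rest = coeff-concatMap h xs-unique (indicator ∘ there) (λ x∈ y∈ → atMostOnce (there x∈) (there y∈))
  disjoint : Q x → Any Q xs → ⊥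
  disjoint qx any with find any
  ... | y , y∈xs , qy = All.lookup x∉xs y∈xs (atMostOnce (here refl) (there y∈xs) qx qy)

map≡concatMap : ∀ {A B : Set} (h : A → B) xs → map h xs ≡ concatMap (λ x → [ h x ]) xs
map≡concatMap h xs = trans (sym (List.concatMap-pure (map h xs))) (List.concatMap-map [_] h xs)

coeff-nearTerm : ∀ b₁ b₂ γ → coeff (nearTerm (1ℚ , b₁) (1ℚ , b₂)) γ indicates NearConcatenation b₁ b₂ γ
coeff-nearTerm b₁ b₂ γ with near b₁ b₂
... | just δ  = indicates-⇔ (coeff-singleton (ℚ.*-identityˡ 1ℚ))
                            (mk⇔ (cong just ∘ sym) (sym ∘ Maybe.just-injective))
... | nothing = (λ ()) , λ _ → refl

module Coefficients (enum : DComp → List DComp) (enum-unique : ∀ α → Unique (enum α))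
                    (enum-spec : ∀ α β → (β ∈ enum α) ⇔ (β ≼ α)) where

  _≼?_ : ∀ γ α → Dec (γ ≼ α)
  γ ≼? α = Dec.map (enum-spec α γ) (γ ∈? enum α)

  private
    ∈⇒≼ : ∀ {α β} → β ∈ enum α → β ≼ α
    ∈⇒≼ {α} {β} = Equivalence.to (enum-spec α β)

    ≼⇒∈ : ∀ {α β} → β ≼ α → β ∈ enum α
    ≼⇒∈ {α} {β} = Equivalence.from (enum-spec α β)

    term : DComp → ℚ × DComp
    term β = 1ℚ , β

  coeff-L : ∀ α γ → coeff (L enum α) γ indicates (γ ≼ α)
  coeff-L α γ = subst (_indicates (γ ≼ α)) (cong (λ f → coeff f γ) (sym (map≡concatMap term (enum α))))
    (indicates-⇔ (coeff-concatMap _ (enum-unique α) (λ _ → coeff-singleton refl)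
                                    (λ _ _ γ≡x γ≡y → trans (sym γ≡x) γ≡y))
                 (enum-spec α γ))

  coeff-pairs : ∀ {R α β γ} (k : DComp → DComp → SQSym) →
    (∀ b₁ b₂ → coeff (k b₁ b₂) γ indicates R b₁ b₂ γ) → PairsUnique R α β γ →
    coeff (concatMap (λ b₁ → concatMap (k b₁) (enum β)) (enum α)) γ indicates RefinedJoin R α β γ
  coeff-pairs {R} {α} {β} {γ} k k-indicates unique =
    indicates-⇔ (coeff-concatMap _ (enum-unique α) inner outer-once) any-any⇔
    where
    inner : ∀ {b₁} → b₁ ∈ enum α →
      coeff (concatMap (k b₁) (enum β)) γ indicates Any (λ b₂ → R b₁ b₂ γ) (enum β)
    inner b₁∈ = coeff-concatMap (k _) (enum-unique β) (λ _ → k-indicates _ _)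
      (λ b₂∈ b₂′∈ r r′ → proj₂ (unique (∈⇒≼ b₁∈) (∈⇒≼ b₂∈) (∈⇒≼ b₁∈) (∈⇒≼ b₂′∈) r r′))
    outer-once : ∀ {b₁ b₁′} → b₁ ∈ enum α → b₁′ ∈ enum α →
      Any (λ b₂ → R b₁ b₂ γ) (enum β) → Any (λ b₂ → R b₁′ b₂ γ) (enum β) → b₁ ≡ b₁′
    outer-once b₁∈ b₁′∈ any any′ with find any | find any′
    ... | _ , b₂∈ , r | _ , b₂′∈ , r′ = proj₁ (unique (∈⇒≼ b₁∈) (∈⇒≼ b₂∈) (∈⇒≼ b₁′∈) (∈⇒≼ b₂′∈) r r′)
    any-any⇔ : Any (λ b₁ → Any (λ b₂ → R b₁ b₂ γ) (enum β)) (enum α) ⇔ RefinedJoin R α β γ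
    any-any⇔ = mk⇔ to from
      where
      to : Any (λ b₁ → Any (λ b₂ → R b₁ b₂ γ) (enum β)) (enum α) → RefinedJoin R α β γ
      to any with find any
      ... | b₁ , b₁∈ , any′ with find any′
      ... | b₂ , b₂∈ , r = b₁ , b₂ , ∈⇒≼ b₁∈ , ∈⇒≼ b₂∈ , r
      from : RefinedJoin R α β γ → Any (λ b₁ → Any (λ b₂ → R b₁ b₂ γ) (enum β)) (enum α)
      from (_ , _ , b₁≼α , b₂≼β , r) = lose (≼⇒∈ b₁≼α) (lose (≼⇒∈ b₂≼β) r)

  coeff-• : ∀ {α β γ} → PairsUnique Concatenation α β γ →
    coeff (L enum α • L enum β) γ indicates RefinedJoin Concatenation α β γ
  coeff-• {α} {β} {γ} unique = subst (λ f → coeff f γ indicates _) (sym expand)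
    (coeff-pairs {Concatenation} (λ b₁ b₂ → [ (1ℚ *ℚ 1ℚ , b₁ ++ b₂) ])
                 (λ _ _ → coeff-singleton (ℚ.*-identityˡ 1ℚ)) unique)
    where
    expand : L enum α • L enum β ≡
             concatMap (λ b₁ → concatMap (λ b₂ → [ (1ℚ *ℚ 1ℚ , b₁ ++ b₂) ]) (enum β)) (enum α)
    expand = trans (List.concatMap-map _ term (enum α))
      (List.concatMap-cong (λ b₁ → trans (sym (List.map-∘ (enum β))) (map≡concatMap _ (enum β))) (enum α))

  coeff-⊙ : ∀ {α β γ} → PairsUnique NearConcatenation α β γ →
    coeff (L enum α ⊙ L enum β) γ indicates RefinedJoin NearConcatenation α β γ
  coeff-⊙ {α} {β} {γ} unique = subst (λ f → coeff f γ indicates _) (sym expand)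
    (coeff-pairs {NearConcatenation} (λ b₁ b₂ → nearTerm (term b₁) (term b₂))
                 (λ b₁ b₂ → coeff-nearTerm b₁ b₂ γ) unique)
    where
    expand : L enum α ⊙ L enum β ≡
             concatMap (λ b₁ → concatMap (λ b₂ → nearTerm (term b₁) (term b₂)) (enum β)) (enum α)
    expand = trans (List.concatMap-map _ term (enum α))
      (List.concatMap-cong (λ b₁ → List.concatMap-map (nearTerm (term b₁)) term (enum β)) (enum α))

mainTheorem3 : (enum : DComp → List DComp)
    → (∀ α → Unique (enum α))
    → (∀ α β → (β ∈ enum α) ⇔ (β ≼ α))
    → ∀ (α β : DComp)
    → (∀ γ → coeff (L enum α • L enum β) γ ≡ coeff (L enum (α ++ β)) γ)
      × (LastNonDotted α → FirstNonDotted β → ∀ δ → near α β ≡ just δ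
          → ∀ γ → coeff ((L enum α • L enum β) ⊕ (L enum α ⊙ L enum β)) γ
                  ≡ coeff (L enum δ) γ)
mainTheorem3 enum enum-unique enum-spec α β = concatenation , nearConcatenation
  where
  open Coefficients enum enum-unique enum-spec

  concatenation : ∀ γ → coeff (L enum α • L enum β) γ ≡ coeff (L enum (α ++ β)) γ
  concatenation γ = indicates-unique
    (indicates-⇔ (coeff-• concatenation-pairs-unique) (refinedConcatenation⇔≼-++ α β))
    (coeff-L (α ++ β) γ) (γ ≼? (α ++ β))

  nearConcatenation : LastNonDotted α → FirstNonDotted β → ∀ δ → near α β ≡ just δ →
    ∀ γ → coeff ((L enum α • L enum β) ⊕ (L enum α ⊙ L enum β)) γ ≡ coeff (L enum δ) γ
  nearConcatenation lastα firstβ δ α⊙β≡δ γ = indicates-unique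
    (subst (_indicates (γ ≼ δ)) (sym (coeff-++ (L enum α • L enum β) (L enum α ⊙ L enum β) γ))
      (indicates-⇔ (indicates-+ (coeff-• concatenation-pairs-unique)
                                (coeff-⊙ (nearConcatenation-pairs-unique lastα firstβ))
                                (concatenation-near-disjoint lastα firstβ))
                   (refinedJoins⇔≼-near lastα firstβ α⊙β≡δ)))
    (coeff-L δ γ) (γ ≼? δ)
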